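{- For any $\delta\in\{ -,+\}$ and any $\delta$-canonical suffix $S$ of $T$, its $\delta$-canonical factoring and its $\delta$-certificate are unique. Consequently, the mapping $\mathrm{cano}_\delta$ is a bijection between $ES_\delta\cup\{f^\bot_\delta\}$ and the set $CS_\delta$ of $\delta$-canonical suffixes.
   Context: Let $T=T[1..n]$ be a text over an integer alphabet with total order, ending with a unique smallest end-marker $\$$. $\le_{\mathrm{lex}}$ is lexicographic order; $X\le_{\mathrm{pos}}Y$ iff $|X|\ge|Y|$. The CDAWG $G$ of $T$ is the edge-labeled DAG obtained from the suffix tree of $T$ by merging isomorphic subtrees; it has a root and a sink, edges with nonempty labels, outgoing edges of a node start with distinct symbols, and spelling root-to-sink paths is a bijection onto the suffixes of $T$; $E$ is its edge set. For a node $v$, $N_-(v)$/$N_+(v)$ are incoming/outgoing edges, $U_-(v)$ the strings spelled by root-to-$v$ paths, $U_+(v)$ those spelled by $v$-to-sink paths. Fix $\preceq_-=\le_{\mathrm{pos}}$, $\preceq_+\in\{\le_{\mathrm{lex}},\le_{\mathrm{pos}}\}$, and $\mathrm{repr}_\delta(v)=\min_{\preceq_\delta}U_\delta(v)$ (strings identified with their unique paths). An edge of $N_-(v)$ is $(-)$-primary if it is the last edge of the path of $\mathrm{repr}_-(v)$; an edge of $N_+(v)$ is $(+)$-primary if it is the first edge of the path of $\mathrm{repr}_+(v)$; $EP_\delta$ = $\delta$-primary edges, $ES_\delta=E\setminus EP_\delta$. $f^\bot_-$, $f^\bot_+$ are imaginary edges not in $E$. A suffix $S$ with root-to-sink path $(f_1,\dots,f_\ell)$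 is $\delta$-trivial if all $f_i\in EP_\delta$ (there is exactly one $\delta$-trivial suffix). A $(-)$-canonical factoring of $S$ at index $k\in[\ell]$: $f_1,\dots,f_{k-1}\in EP_-$, $f_k\in ES_-$ ($f_k$ being the highest $ES_-$-edge of the path), $f_{k+1},\dots,f_\ell\in EP_+$; a $(+)$-canonical factoring at $k$: $f_1,\dots,f_{k-1}\in EP_-$, $f_k\in ES_+$ ($f_k$ being the lowest $ES_+$-edge), $f_{k+1},\dots,f_\ell\in EP_+$; the factoring is $S=\mathrm{str}(f_1\cdots f_{k-1})\cdot \mathrm{lab}(f_k)\cdot \mathrm{str}(f_{k+1}\cdots f_\ell)$. $S$ is $\delta$-canonical if it is $\delta$-trivial (with $\delta$-certificate $f^\bot_\delta$) or has a $\delta$-canonical factoring at some $k$ (with $\delta$-certificate $f_k$). $\mathrm{cano}_\delta(f)$ is the $\delta$-canonical suffix with $\delta$-certificate $f$. -}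

module Defs where

open import Data.Nat using (ℕ; _<_; _≤_; _+_)
open import Data.List using (List; []; _∷_; _++_; take; drop; length; concatMap)
open import Data.List.Relation.Unary.All using (All)
open import Data.Product using (Σ; _×_; _,_; ∃; proj₁; proj₂)
open import Data.Sum using (_⊎_)
open import Data.Maybe using (Maybe; just; nothing)
open import Relation.Binary.PropositionalEquality using (_≡_; _≢_)
open import Relation.Nullary using (¬_)

-- Strings and texts over the integer alphabet ℕ (positions 0-based)

Str : Set
Str = List ℕ

EndMarked : Str → Set
EndMarked T = Σ Str λ T' → Σ ℕ λ d → (T ≡ T' ++ (d ∷ [])) × All (d <_) T'

Occ : Str → Str → ℕ → Set
Occ T x i = take (length x) (drop i T) ≡ x

EndsAt : Str → Str → ℕ → Set
EndsAt T x j = Σ ℕ λ i → Occ T x i × (i + length x ≡ j)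

Substring : Str → Str → Set
Substring T x = Σ ℕ λ i → Occ T x i

EndposEq : Str → Str → Str → Set
EndposEq T x y = ∀ j → (EndsAt T x j → EndsAt T y j) × (EndsAt T y j → EndsAt T x j)

RightBranching : Str → Str → Set
RightBranching T x = Σ ℕ λ a → Σ ℕ λ b → (a ≢ b) × Substring T (x ++ (a ∷ [])) × Substring T (x ++ (b ∷ []))

Suffix : Str → Str → Set
Suffix T x = Σ ℕ λ i → (i < length T) × (drop i T ≡ x)

-- explicit nodes of the suffix tree of T: root, branching nodes, leaves
STNode : Str → Str → Set
STNode T x = (x ≡ []) ⊎ (Substring T x × RightBranching T x) ⊎ Suffix T x

-- CDAWG nodes: the longest member of the end-position class of a suffix-tree
-- node (merging isomorphic subtrees of the suffix tree = merging nodes with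
-- equal end-position sets).  Root = [], sink = T.
CNode : Str → Str → Set
CNode T y = STNode T y × (∀ z → EndposEq T z y → length z ≤ length y)

Edge : Set
Edge = Str × Str × Str

src : Edge → Str
src (u , _ , _) = u

lab : Edge → Str
lab (_ , l , _) = l

tgt : Edge → Str
tgt (_ , _ , v) = v

-- (x , l , y) is an edge of the CDAWG of T: from the suffix-tree node x, the
-- suffix-tree edge with label l leads to the suffix-tree node x ++ l (no
-- suffix-tree node strictly in between), and y is the CDAWG node of the
-- end-position class of x ++ l.
IsEdge : Str → Edge → Set
IsEdge T (x , l , y) =
  CNode T x × CNode T y × (l ≢ []) × STNode T (x ++ l)
  × (∀ β γ → β ++ γ ≡ l → β ≢ [] → γ ≢ [] → ¬ STNode T (x ++ β))
  × EndposEq T (x ++ l) y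

data Path (T : Str) : Str → Str → List Edge → Set where
  []  : ∀ {u} → Path T u u []
  _∷_ : ∀ {l w v es} {u : Str} → IsEdge T (u , l , w) → Path T w v es →
        Path T u v ((u , l , w) ∷ es)

str : List Edge → Str
str es = concatMap lab es

data _≤lex_ : Str → Str → Set where
  []≤  : ∀ {y} → [] ≤lex y
  <≤   : ∀ {a b x y} → a < b → (a ∷ x) ≤lex (b ∷ y)
  ≡≤   : ∀ {a x y} → x ≤lex y → (a ∷ x) ≤lex (a ∷ y)

_≤pos_ : Str → Str → Set
X ≤pos Y = length Y ≤ length X

-- the choice for ⪯₊
data Order : Set where
  lexO posO : Order

_⟨_⟩_ : Str → Order → Str → Set
X ⟨ lexO ⟩ Y = X ≤lex Y
X ⟨ posO ⟩ Y = X ≤pos Y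

data Sign : Set where
  minus plus : Sign

ReprM : Str → Str → List Edge → Set
ReprM T v p = Path T [] v p × (∀ q → Path T [] v q → str p ≤pos str q)

ReprP : Str → Order → Str → List Edge → Set
ReprP T o v p = Path T v T p × (∀ q → Path T v T q → str p ⟨ o ⟩ str q)

EPm : Str → Edge → Set
EPm T e = IsEdge T e × Σ (List Edge) λ q → ReprM T (tgt e) (q ++ (e ∷ []))

EPp : Str → Order → Edge → Set
EPp T o e = IsEdge T e × Σ (List Edge) λ q → ReprP T o (src e) (e ∷ q)

EP : Str → Order → Sign → Edge → Set
EP T o minus e = EPm T e
EP T o plus  e = EPp T o e

ES : Str → Order → Sign → Edge → Set
ES T o δ e = IsEdge T e × ¬ EP T o δ e

Trivial : Str → Order → Sign → Str → Set
Trivial T o δ S = Σ (List Edge) λ p → Path T [] T p × (str p ≡ S) × All (EP T o δ) p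

-- (pre , f , post) is a δ-canonical factoring of S, at index k = |pre| + 1.
-- (The clauses "f highest ES₋-edge" / "f lowest ES₊-edge" follow from the
-- other conditions and are stated anyway for fidelity.)
Factoring : Str → Order → Sign → Str → List Edge → Edge → List Edge → Set
Factoring T o δ S pre f post =
  Path T [] T (pre ++ f ∷ post) × (str (pre ++ f ∷ post) ≡ S)
  × All (EPm T) pre × ES T o δ f × All (EPp T o) post
  × Extremal δ
  where
  Extremal : Sign → Set
  Extremal minus = All (λ e → ¬ ES T o minus e) pre
  Extremal plus  = All (λ e → ¬ ES T o plus e) post

-- c is the δ-certificate of S (nothing = the imaginary edge f^⊥_δ)
Cert : Str → Order → Sign → Str → Maybe Edge → Set
Cert T o δ S c =
  ((c ≡ nothing) × Trivial T o δ S)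
  ⊎ (Σ (List Edge) λ pre → Σ Edge λ f → Σ (List Edge) λ post →
       (c ≡ just f) × Factoring T o δ S pre f post)

Canonical : Str → Order → Sign → Str → Set
Canonical T o δ S = Σ (Maybe Edge) λ c → Cert T o δ S c

Dom : Str → Order → Sign → Maybe Edge → Set
Dom T o δ c = (c ≡ nothing) ⊎ (Σ Edge λ f → (c ≡ just f) × ES T o δ f)

{-# OPTIONS --safe #-}
-- A CDAWG path is determined by the string it spells: labels leaving the same node are not proper
-- prefixes of one another, since the end of the shorter one would be a suffix-tree node inside the
-- longer edge. So a suffix fixes its root-to-sink path and, on it, the highest (−) or lowest (+)
-- secondary edge; this gives uniqueness of factorings and certificates. A path of primary edges is
-- the representative path of its end, because representatives are unique; hence the canonical suffix
-- with certificate f = (u, l, w) can only be repr₋(u) l repr₊(w), and this string is indeed canonical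
-- with certificate f (likewise the trivial suffix is repr₋(sink), resp. repr₊(root)). Representatives
-- exist because every node is reached from the root and reaches the sink (the unique end-marker makes
-- every suffix of T end-position equivalent to T), and only finitely many candidates are compared.
module Submission where

open import Defs
open import Data.Nat using (ℕ; zero; suc; _+_; _∸_; _⊓_; _≤_; _<_; z≤n; s≤s; _≟_; _≤?_)
open import Data.Nat.Properties
open import Data.List using (List; []; _∷_; _++_; take; drop; length)
open import Data.List.Properties
  using (++-assoc; ++-identityʳ; ++-conicalˡ; ++-conicalʳ; ++-cancelˡ; length-++; length-take; length-drop;
         take-all; take-drop; concatMap-++; drop-drop; take++drop≡id; ∷-injectiveˡ; ∷-injectiveʳ; ≡-dec)
open import Data.List.Membership.Propositional using (_∈_)
open import Data.List.Relation.Unary.All as All using (All; []; _∷_)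
open import Data.List.Relation.Unary.All.Properties using (++⁻ʳ)
open import Data.List.Relation.Unary.Any as Any using (here; there; any?; satisfied)
open import Data.Maybe using (Maybe; just)
open import Data.Maybe.Properties using (just-injective)
open import Data.Product using (Σ; _×_; _,_; ∃; proj₁; proj₂)
open import Data.Sum using (_⊎_; inj₁; inj₂)
open import Data.Empty using (⊥-elim)
open import Relation.Binary.PropositionalEquality
open import Relation.Binary.Definitions using (tri<; tri≈; tri>)
open import Relation.Nullary using (¬_; Dec; yes; no)
open import Relation.Nullary.Decidable using (_×-dec_; _⊎-dec_; _→-dec_; ¬?)

take-++⁻ : ∀ {A : Set} (xs a c : List A) → take (length a + length c) xs ≡ a ++ c →
  take (length a) xs ≡ a × take (length c) (drop (length a) xs) ≡ c
take-++⁻ xs       []      c eq = refl , eq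
take-++⁻ []       (x ∷ a) c ()
take-++⁻ (y ∷ ys) (x ∷ a) c eq with ∷-injectiveˡ eq
... | refl = let (ea , ec) = take-++⁻ ys a c (∷-injectiveʳ eq) in cong (y ∷_) ea , ec

take-++⁺ : ∀ {A : Set} (xs a c : List A) → take (length a) xs ≡ a → take (length c) (drop (length a) xs) ≡ c →
  take (length a + length c) xs ≡ a ++ c
take-++⁺ xs       []      c ea ec = ec
take-++⁺ []       (x ∷ a) c () ec
take-++⁺ (y ∷ ys) (x ∷ a) c ea ec with ∷-injectiveˡ ea
... | refl = cong (y ∷_) (take-++⁺ ys a c (∷-injectiveʳ ea) ec)

occ-++⁻ : ∀ T a c i → Occ T (a ++ c) i → Occ T a i × Occ T c (i + length a)
occ-++⁻ T a c i o rewrite length-++ a {c} with take-++⁻ (drop i T) a c o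
... | oa , oc = oa , subst (λ z → take (length c) z ≡ c) (drop-drop i (length a) T) oc

occ-++⁺ : ∀ T a c i → Occ T a i → Occ T c (i + length a) → Occ T (a ++ c) i
occ-++⁺ T a c i oa oc rewrite length-++ a {c} =
  take-++⁺ (drop i T) a c oa (subst (λ z → take (length c) z ≡ c) (sym (drop-drop i (length a) T)) oc)

occ-length≤ : ∀ T x i → Occ T x i → length x ≤ length T
occ-length≤ T x i o = begin
  length x                               ≡⟨ cong length o ⟨
  length (take (length x) (drop i T))    ≡⟨ length-take (length x) (drop i T) ⟩
  length x ⊓ length (drop i T)           ≤⟨ m⊓n≤n (length x) _ ⟩
  length (drop i T)                      ≡⟨ length-drop i T ⟩
  length T ∸ i                           ≤⟨ m∸n≤m (length T) i ⟩
  length T                               ∎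
  where open ≤-Reasoning

occ-end≤ : ∀ T c x i → Occ T (c ∷ x) i → i + length (c ∷ x) ≤ length T
occ-end≤ (t ∷ T) c x zero    o = s≤s (occ-length≤ T x 0 (∷-injectiveʳ o))
occ-end≤ (t ∷ T) c x (suc i) o = s≤s (occ-end≤ T c x i o)

occ-unique : ∀ T x y i → Occ T x i → Occ T y i → length x ≡ length y → x ≡ y
occ-unique T x y i ox oy eq = trans (sym ox) (trans (cong (λ n → take n (drop i T)) eq) oy)

++≡++⇒prefix : ∀ {A : Set} (l s l′ s′ : List A) → l ++ s ≡ l′ ++ s′ →
  (∃ λ γ → l′ ≡ l ++ γ) ⊎ (∃ λ γ → l ≡ l′ ++ γ)
++≡++⇒prefix []      s l′       s′ eq = inj₁ (l′ , refl)
++≡++⇒prefix (x ∷ l) s []       s′ eq = inj₂ (x ∷ l , refl)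
++≡++⇒prefix (x ∷ l) s (y ∷ l′) s′ eq with ∷-injectiveˡ eq | ++≡++⇒prefix l s l′ s′ (∷-injectiveʳ eq)
... | refl | inj₁ (γ , q) = inj₁ (γ , cong (x ∷_) q)
... | refl | inj₂ (γ , q) = inj₂ (γ , cong (x ∷_) q)

length-str-++ : ∀ (a b : List Edge) → length (str (a ++ b)) ≡ length (str a) + length (str b)
length-str-++ a b = trans (cong length (concatMap-++ lab a b)) (length-++ (str a))

module EndPositions (T : Str) where

  ep-refl : ∀ x → EndposEq T x x
  ep-refl x j = (λ a → a) , (λ a → a)

  ep-sym : ∀ {x y} → EndposEq T x y → EndposEq T y x
  ep-sym e j = proj₂ (e j) , proj₁ (e j)

  ep-trans : ∀ {x y z} → EndposEq T x y → EndposEq T y z → EndposEq T x z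
  ep-trans e₁ e₂ j = (λ a → proj₁ (e₂ j) (proj₁ (e₁ j) a)) , (λ a → proj₂ (e₁ j) (proj₂ (e₂ j) a))

  endsAt-++ : ∀ {a b} c {j} → EndposEq T a b → EndsAt T (a ++ c) j → EndsAt T (b ++ c) j
  endsAt-++ {a} {b} c {j} e (i , o , end) with occ-++⁻ T a c i o
  ... | oa , oc with proj₁ (e (i + length a)) (i , oa , refl)
  ... | i′ , ob , end′ = i′ , occ-++⁺ T b c i′ ob (subst (Occ T c) (sym end′) oc) , end″
    where
    open ≡-Reasoning
    end″ : i′ + length (b ++ c) ≡ j
    end″ = begin
      i′ + length (b ++ c)       ≡⟨ cong (i′ +_) (length-++ b) ⟩
      i′ + (length b + length c) ≡⟨ +-assoc i′ (length b) (length c) ⟨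
      i′ + length b + length c   ≡⟨ cong (_+ length c) end′ ⟩
      i + length a + length c    ≡⟨ +-assoc i (length a) (length c) ⟩
      i + (length a + length c)  ≡⟨ cong (i +_) (length-++ a) ⟨
      i + length (a ++ c)        ≡⟨ end ⟩
      j                          ∎

  endsAt-++⁻ʳ : ∀ a {c j} → EndsAt T (a ++ c) j → EndsAt T c j
  endsAt-++⁻ʳ a {c} (i , o , end) =
    i + length a , proj₂ (occ-++⁻ T a c i o) ,
    trans (+-assoc i (length a) (length c)) (trans (cong (i +_) (sym (length-++ a))) end)

  ep-++ʳ : ∀ {a b} c → EndposEq T a b → EndposEq T (a ++ c) (b ++ c)
  ep-++ʳ c e j = endsAt-++ c e , endsAt-++ c (ep-sym e)

  endsAt-unique : ∀ {x y j} → EndsAt T x j → EndsAt T y j → length x ≡ length y → x ≡ y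
  endsAt-unique {x} {y} (i , ox , end) (i′ , oy , end′) eq
    with +-cancelʳ-≡ (length y) i i′ (trans (cong (i +_) (sym eq)) (trans end (sym end′)))
  ... | refl = occ-unique T x y i ox oy eq

  substring⇒endsAt : ∀ {x} → Substring T x → ∃ (EndsAt T x)
  substring⇒endsAt {x} (i , o) = i + length x , i , o , refl

  ep-substring : ∀ {x y} → EndposEq T x y → Substring T x → Substring T y
  ep-substring e s with proj₁ (e _) (proj₂ (substring⇒endsAt s))
  ... | i , o , _ = i , o

  ep-length⇒≡ : ∀ {x y} → EndposEq T x y → Substring T y → length x ≡ length y → x ≡ y
  ep-length⇒≡ e s = endsAt-unique (proj₂ (e _) (proj₂ (substring⇒endsAt s))) (proj₂ (substring⇒endsAt s))

  -- [] ends at every position, in particular one past the end of T.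
  ep-[] : ∀ {z} → EndposEq T z [] → z ≡ []
  ep-[] {[]}    e = refl
  ep-[] {c ∷ z} e with proj₂ (e (suc (length T))) (suc (length T) , refl , +-identityʳ _)
  ... | i , o , end = ⊥-elim (1+n≰n (subst (_≤ length T) end (occ-end≤ T c z i o)))

  ep-≢[] : ∀ {x y} → EndposEq T x y → x ≢ [] → y ≢ []
  ep-≢[] e x≢[] refl = x≢[] (ep-[] e)

≤lex-refl : ∀ x → x ≤lex x
≤lex-refl []      = []≤
≤lex-refl (a ∷ x) = ≡≤ (≤lex-refl x)

≤lex-trans : ∀ {x y z} → x ≤lex y → y ≤lex z → x ≤lex z
≤lex-trans []≤    _      = []≤
≤lex-trans (<≤ p) (<≤ q) = <≤ (<-trans p q)
≤lex-trans (<≤ p) (≡≤ q) = <≤ p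
≤lex-trans (≡≤ p) (<≤ q) = <≤ q
≤lex-trans (≡≤ p) (≡≤ q) = ≡≤ (≤lex-trans p q)

≤lex-antisym : ∀ {x y} → x ≤lex y → y ≤lex x → x ≡ y
≤lex-antisym []≤    []≤    = refl
≤lex-antisym (<≤ p) (<≤ q) = ⊥-elim (<-asym p q)
≤lex-antisym (<≤ p) (≡≤ q) = ⊥-elim (<-irrefl refl p)
≤lex-antisym (≡≤ p) (<≤ q) = ⊥-elim (<-irrefl refl q)
≤lex-antisym (≡≤ p) (≡≤ q) = cong (_ ∷_) (≤lex-antisym p q)

≤lex-total : ∀ x y → x ≤lex y ⊎ y ≤lex x
≤lex-total []      y       = inj₁ []≤
≤lex-total (a ∷ x) []      = inj₂ []≤
≤lex-total (a ∷ x) (b ∷ y) with <-cmp a b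
... | tri< a<b _ _ = inj₁ (<≤ a<b)
... | tri> _ _ b<a = inj₂ (<≤ b<a)
... | tri≈ _ refl _ with ≤lex-total x y
...   | inj₁ x≤y = inj₁ (≡≤ x≤y)
...   | inj₂ y≤x = inj₂ (≡≤ y≤x)

≤lex-cancelˡ : ∀ w {x y} → (w ++ x) ≤lex (w ++ y) → x ≤lex y
≤lex-cancelˡ []      p      = p
≤lex-cancelˡ (a ∷ w) (<≤ p) = ⊥-elim (<-irrefl refl p)
≤lex-cancelˡ (a ∷ w) (≡≤ p) = ≤lex-cancelˡ w p

⟨⟩-refl : ∀ o x → x ⟨ o ⟩ x
⟨⟩-refl lexO x = ≤lex-refl x
⟨⟩-refl posO x = ≤-refl

⟨⟩-trans : ∀ o {x y z} → x ⟨ o ⟩ y → y ⟨ o ⟩ z → x ⟨ o ⟩ z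
⟨⟩-trans lexO p q = ≤lex-trans p q
⟨⟩-trans posO p q = ≤-trans q p

⟨⟩-total : ∀ o x y → x ⟨ o ⟩ y ⊎ y ⟨ o ⟩ x
⟨⟩-total lexO x y = ≤lex-total x y
⟨⟩-total posO x y with ≤-total (length x) (length y)
... | inj₁ p = inj₂ p
... | inj₂ p = inj₁ p

⟨⟩-cancelˡ : ∀ o w {x y} → (w ++ x) ⟨ o ⟩ (w ++ y) → x ⟨ o ⟩ y
⟨⟩-cancelˡ lexO w p = ≤lex-cancelˡ w p
⟨⟩-cancelˡ posO w {x} {y} p rewrite length-++ w {x} | length-++ w {y} = +-cancelˡ-≤ (length w) _ _ p

Least : Order → (Str → Set) → List Str → Str → Set
Least o Q xs m = Q m × (∀ y → y ∈ xs → Q y → m ⟨ o ⟩ y)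

least : ∀ o {Q : Str → Set} → (∀ x → Dec (Q x)) → ∀ xs → (∀ y → y ∈ xs → ¬ Q y) ⊎ ∃ (Least o Q xs)
least o Q? [] = inj₁ λ _ ()
least o Q? (x ∷ xs) with Q? x | least o Q? xs
... | no ¬qx | inj₁ none = inj₁ λ { y (here refl) → ¬qx ; y (there y∈) → none y y∈ }
... | no ¬qx | inj₂ (m , qm , best) = inj₂ (m , qm , λ { y (here refl) q → ⊥-elim (¬qx q) ; y (there y∈) → best y y∈ })
... | yes qx | inj₁ none = inj₂ (x , qx , λ { y (here refl) _ → ⟨⟩-refl o x ; y (there y∈) q → ⊥-elim (none y y∈ q) })
... | yes qx | inj₂ (m , qm , best) with ⟨⟩-total o x m
...   | inj₁ x≤m =
  inj₂ (x , qx , λ { y (here refl) _ → ⟨⟩-refl o x ; y (there y∈) q → ⟨⟩-trans o x≤m (best y y∈ q) })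
...   | inj₂ m≤x = inj₂ (m , qm , λ { y (here refl) _ → m≤x ; y (there y∈) → best y y∈ })

least-exists : ∀ o {Q : Str → Set} → (∀ x → Dec (Q x)) → ∀ xs {y} → y ∈ xs → Q y → ∃ (Least o Q xs)
least-exists o Q? xs y∈ qy with least o Q? xs
... | inj₁ none = ⊥-elim (none _ y∈ qy)
... | inj₂ m    = m

suffixes : Str → List Str
suffixes []      = [] ∷ []
suffixes (t ∷ s) = (t ∷ s) ∷ suffixes s

drop∈suffixes : ∀ m xs → drop m xs ∈ suffixes xs
drop∈suffixes zero    []       = here refl
drop∈suffixes zero    (x ∷ xs) = here refl
drop∈suffixes (suc m) []       = here refl
drop∈suffixes (suc m) (x ∷ xs) = there (drop∈suffixes m xs)

endsAt⇒∈suffixes : ∀ T z j → EndsAt T z j → z ∈ suffixes (take j T)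
endsAt⇒∈suffixes T z j (i , o , end) = subst (_∈ suffixes (take j T)) z≡ (drop∈suffixes i (take j T))
  where
  z≡ : drop i (take j T) ≡ z
  z≡ = trans (cong (λ k → drop i (take k T)) (sym end)) (trans (sym (take-drop (length z) i T)) o)

str? : (x y : Str) → Dec (x ≡ y)
str? = ≡-dec _≟_

substring? : ∀ T x → Dec (Substring T x)
substring? []      []      = yes (0 , refl)
substring? []      (c ∷ x) = no λ { (zero , ()) ; (suc i , ()) }
substring? (t ∷ T) x with str? (take (length x) (t ∷ T)) x | substring? T x
... | yes o | _            = yes (0 , o)
... | no ¬o | yes (i , o)  = yes (suc i , o)
... | no ¬o | no ¬s        = no λ { (zero , o) → ¬o o ; (suc i , o) → ¬s (i , o) }

suffix? : ∀ T x → Dec (Suffix T x)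
suffix? []      x = no λ { (i , () , _) }
suffix? (t ∷ T) x with str? (t ∷ T) x | suffix? T x
... | yes eq | _                  = yes (0 , s≤s z≤n , eq)
... | no ¬eq | yes (i , i< , eq)  = yes (suc i , s≤s i< , eq)
... | no ¬eq | no ¬s              = no λ { (zero , _ , eq) → ¬eq eq ; (suc i , s≤s i< , eq) → ¬s (i , i< , eq) }

occ⇒∈ : ∀ T a i → Occ T (a ∷ []) i → a ∈ T
occ⇒∈ (t ∷ T) a zero    o = here (sym (∷-injectiveˡ o))
occ⇒∈ (t ∷ T) a (suc i) o = there (occ⇒∈ T a i o)

-- The two branching symbols occur in T, so it suffices to search T × T.
rightBranching? : ∀ T x → Dec (RightBranching T x)
rightBranching? T x with any? (λ a → any? (λ b → Branch? a b) T) T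
  where
  Branch? : ∀ a b → Dec ((a ≢ b) × Substring T (x ++ a ∷ []) × Substring T (x ++ b ∷ []))
  Branch? a b = ¬? (a ≟ b) ×-dec substring? T (x ++ a ∷ []) ×-dec substring? T (x ++ b ∷ [])
... | yes found with satisfied found
...   | a , found-b with satisfied found-b
...     | b , branch = yes (a , b , branch)
rightBranching? T x | no none = no λ { (a , b , branch@(_ , xa , xb)) →
  none (Any.map (λ { refl → Any.map (λ { refl → branch }) (∈T b xb) }) (∈T a xa)) }
  where
  ∈T : ∀ a → Substring T (x ++ a ∷ []) → a ∈ T
  ∈T a (i , o) = occ⇒∈ T a (i + length x) (proj₂ (occ-++⁻ T x (a ∷ []) i o))

stnode? : ∀ T x → Dec (STNode T x)
stnode? T x = str? x [] ⊎-dec ((substring? T x ×-dec rightBranching? T x) ⊎-dec suffix? T x)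

endsAt? : ∀ T x j → Dec (EndsAt T x j)
endsAt? T x j with length x ≤? j
... | no |x|≰j = no λ { (i , _ , end) → |x|≰j (subst (length x ≤_) end (m≤n+m (length x) i)) }
... | yes |x|≤j with str? (take (length x) (drop (j ∸ length x) T)) x
...   | yes o  = yes (j ∸ length x , o , m∸n+n≡m |x|≤j)
...   | no ¬o  = no λ { (i , o , end) → ¬o (subst (Occ T x) (start end) o) }
  where
  start : ∀ {i} → i + length x ≡ j → i ≡ j ∸ length x
  start {i} end = trans (sym (m+n∸n≡m i (length x))) (cong (_∸ length x) end)

endsAt≤length : ∀ T x j → EndsAt T x j → x ≢ [] → j ≤ length T
endsAt≤length T []      j _              x≢[] = ⊥-elim (x≢[] refl)
endsAt≤length T (c ∷ x) j (i , o , end) _    = subst (_≤ length T) end (occ-end≤ T c x i o)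

SameEndsAt : Str → Str → Str → ℕ → Set
SameEndsAt T z x j = (EndsAt T z j → EndsAt T x j) × (EndsAt T x j → EndsAt T z j)

-- End positions of nonempty strings lie in [0, |T|], so the quantifier over j is bounded.
endposEq? : ∀ T z x → x ≢ [] → Dec (EndposEq T z x)
endposEq? T []      x x≢[] = no λ e → x≢[] (EndPositions.ep-[] T (EndPositions.ep-sym T e))
endposEq? T (c ∷ z) x x≢[] with allUpTo? sameAt? (suc (length T))
  where
  sameAt? : ∀ j → Dec (SameEndsAt T (c ∷ z) x j)
  sameAt? j = (endsAt? T (c ∷ z) j →-dec endsAt? T x j) ×-dec (endsAt? T x j →-dec endsAt? T (c ∷ z) j)
... | no ¬same = no λ e → ¬same λ {j} _ → e j
... | yes same = yes λ j → sameAt j (j ≤? length T)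
  where
  sameAt : ∀ j → Dec (j ≤ length T) → SameEndsAt T (c ∷ z) x j
  sameAt j (yes j≤) = same (s≤s j≤)
  sameAt j (no j≰)  = (λ ea → ⊥-elim (j≰ (endsAt≤length T (c ∷ z) j ea λ ()))) ,
                      (λ ea → ⊥-elim (j≰ (endsAt≤length T x j ea x≢[])))

module Nodes (T : Str) where
  open EndPositions T

  stnode-substring : ∀ {x} → STNode T x → Substring T x
  stnode-substring (inj₁ refl)                 = 0 , refl
  stnode-substring (inj₂ (inj₁ (s , _)))       = s
  stnode-substring {x} (inj₂ (inj₂ (i , _ , eq))) =
    i , trans (cong (take (length x)) eq) (take-all (length x) x ≤-refl)

  cnode-unique : ∀ {y y′} → CNode T y → CNode T y′ → EndposEq T y y′ → y ≡ y′
  cnode-unique {y} {y′} (_ , longest) (st′ , longest′) e =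
    ep-length⇒≡ e (stnode-substring st′) (≤-antisym (longest′ y e) (longest y′ (ep-sym e)))

  cnode-root : CNode T []
  cnode-root = inj₁ refl , λ z e → ≤-reflexive (cong length (ep-[] e))

  suffix⇒endsAt : ∀ {x} → Suffix T x → EndsAt T x (length T)
  suffix⇒endsAt {x} (i , i< , eq) =
    i , trans (cong (take (length x)) eq) (take-all (length x) x ≤-refl) ,
    trans (cong (i +_) (trans (cong length (sym eq)) (length-drop i T))) (m+[n∸m]≡n (<⇒≤ i<))

  endsAt⇒suffix : ∀ {y} → y ≢ [] → EndsAt T y (length T) → Suffix T y
  endsAt⇒suffix {[]}    y≢[] _ = ⊥-elim (y≢[] refl)
  endsAt⇒suffix {c ∷ y} _    (k , o , end) = k , k< , trans (sym (take-all (length (c ∷ y)) (drop k T) short)) o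
    where
    short : length (drop k T) ≤ length (c ∷ y)
    short = ≤-reflexive (trans (length-drop k T) (trans (cong (_∸ k) (sym end)) (m+n∸m≡n k (length (c ∷ y)))))
    k< : k < length T
    k< = subst (k <_) end (subst (k <_) (sym (+-suc k (length y))) (s≤s (m≤m+n k (length y))))

  stnode-ep : ∀ {x y} → EndposEq T x y → y ≢ [] → STNode T x → STNode T y
  stnode-ep e y≢[] (inj₁ refl) = ⊥-elim (y≢[] (ep-[] (ep-sym e)))
  stnode-ep e y≢[] (inj₂ (inj₁ (s , (a , b , a≢b , xa , xb)))) =
    inj₂ (inj₁ (ep-substring e s , a , b , a≢b , ep-substring (ep-++ʳ (a ∷ []) e) xa , ep-substring (ep-++ʳ (b ∷ []) e) xb))
  stnode-ep e y≢[] (inj₂ (inj₂ suf)) = inj₂ (inj₂ (endsAt⇒suffix y≢[] (proj₁ (e _) (suffix⇒endsAt suf))))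

  -- Every member of the class of x ends at i + |x|, so the longest one is found among the suffixes of T[0, i + |x|).
  cnode-of-class : ∀ x → x ≢ [] → STNode T x → ∃ λ y → CNode T y × EndposEq T x y
  cnode-of-class x x≢[] st with stnode-substring st
  ... | i , o with least-exists posO (λ z → endposEq? T z x x≢[]) (suffixes (take (i + length x) T))
                     (endsAt⇒∈suffixes T x _ (i , o , refl)) (ep-refl x)
  ... | y , y~x , longest = y , (stnode-ep (ep-sym y~x) (ep-≢[] (ep-sym y~x) x≢[]) st , longest′) , ep-sym y~x
    where
    longest′ : ∀ z → EndposEq T z y → length z ≤ length y
    longest′ z z~y = longest z (endsAt⇒∈suffixes T z _ (proj₂ (ep-trans z~y y~x _) (i , o , refl))) (ep-trans z~y y~x)

module _ {T x l y : Str} (e : IsEdge T (x , l , y)) where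

  edge-source : CNode T x
  edge-source = proj₁ e

  edge-target : CNode T y
  edge-target = proj₁ (proj₂ e)

  edge-label≢[] : l ≢ []
  edge-label≢[] = proj₁ (proj₂ (proj₂ e))

  edge-end-node : STNode T (x ++ l)
  edge-end-node = proj₁ (proj₂ (proj₂ (proj₂ e)))

  edge-no-inner-node : ∀ β γ → β ++ γ ≡ l → β ≢ [] → γ ≢ [] → ¬ STNode T (x ++ β)
  edge-no-inner-node = proj₁ (proj₂ (proj₂ (proj₂ (proj₂ e))))

  edge-class : EndposEq T (x ++ l) y
  edge-class = proj₂ (proj₂ (proj₂ (proj₂ (proj₂ e))))

module Paths (T : Str) where
  open EndPositions T
  open Nodes T

  -- A label cannot be a proper prefix of another label out of the same node: its end would be a node inside that edge.
  edge-label-unique : ∀ {u l w l′ w′} s s′ → IsEdge T (u , l , w) → IsEdge T (u , l′ , w′) →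
    l ++ s ≡ l′ ++ s′ → l ≡ l′
  edge-label-unique {l = l} {l′ = l′} s s′ e e′ eq with ++≡++⇒prefix l s l′ s′ eq
  ... | inj₁ ([] , q)     = sym (trans q (++-identityʳ l))
  ... | inj₁ (c ∷ γ , q)  = ⊥-elim (edge-no-inner-node e′ l (c ∷ γ) (sym q) (edge-label≢[] e) (λ ()) (edge-end-node e))
  ... | inj₂ ([] , q)     = trans q (++-identityʳ l′)
  ... | inj₂ (c ∷ γ , q)  = ⊥-elim (edge-no-inner-node e l′ (c ∷ γ) (sym q) (edge-label≢[] e′) (λ ()) (edge-end-node e′))

  edge-target-unique : ∀ {u l w w′} → IsEdge T (u , l , w) → IsEdge T (u , l , w′) → w ≡ w′
  edge-target-unique e e′ = cnode-unique (edge-target e) (edge-target e′) (ep-trans (ep-sym (edge-class e)) (edge-class e′))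

  path-unique : ∀ {u v v′ p p′} → Path T u v p → Path T u v′ p′ → str p ≡ str p′ → p ≡ p′
  path-unique [] [] _ = refl
  path-unique [] (_∷_ {l = l} {es = es} e _) eq = ⊥-elim (edge-label≢[] e (++-conicalˡ l (str es) (sym eq)))
  path-unique (_∷_ {l = l} {es = es} e _) [] eq = ⊥-elim (edge-label≢[] e (++-conicalˡ l (str es) eq))
  path-unique (_∷_ {l = l} {es = es} e ps) (_∷_ {es = es′} e′ ps′) eq
    with edge-label-unique (str es) (str es′) e e′ eq
  ... | refl with edge-target-unique e e′
  ...   | refl = cong (_ ∷_) (path-unique ps ps′ (++-cancelˡ l (str es) (str es′) eq))

  path-++ : ∀ {u m v a b} → Path T u m a → Path T m v b → Path T u v (a ++ b)
  path-++ []       q = q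
  path-++ (e ∷ ps) q = e ∷ path-++ ps q

  path-split : ∀ {u v} a {b} → Path T u v (a ++ b) → ∃ λ m → Path T u m a × Path T m v b
  path-split []      ps = _ , [] , ps
  path-split (_ ∷ a) (e ∷ ps) with path-split a ps
  ... | m , pa , pb = m , e ∷ pa , pb

  path-around : ∀ {u v} pre f post → Path T u v (pre ++ f ∷ post) → Path T u (src f) pre × Path T (tgt f) v post
  path-around pre f post ps with path-split pre ps
  ... | _ , pa , (_ ∷ pb) = pa , pb

  path-endpos : ∀ {u v p} → Path T u v p → EndposEq T (u ++ str p) v
  path-endpos {u} [] = subst (λ z → EndposEq T z u) (sym (++-identityʳ u)) (ep-refl u)
  path-endpos {u} (_∷_ {l = l} {es = es} e ps) =
    subst (λ z → EndposEq T z _) (++-assoc u l (str es)) (ep-trans (ep-++ʳ (str es) (edge-class e)) (path-endpos ps))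

  path-substring : ∀ {u v p} → Path T u v p → Substring T u → Substring T v
  path-substring []       s = s
  path-substring (e ∷ ps) _ = path-substring ps (stnode-substring (proj₁ (edge-target e)))

  no-edge-from-sink : ∀ {l w} → ¬ IsEdge T (T , l , w)
  no-edge-from-sink {l} e = too-long l (edge-label≢[] e) (stnode-length≤ (edge-end-node e))
    where
    stnode-length≤ : ∀ {x} → STNode T x → length x ≤ length T
    stnode-length≤ st with stnode-substring st
    ... | i , o = occ-length≤ T _ i o
    too-long : ∀ l → l ≢ [] → ¬ length (T ++ l) ≤ length T
    too-long []      l≢[] _ = l≢[] refl
    too-long (_ ∷ l) _    p = m+1+n≰m (length T) (subst (_≤ length T) (length-++ T) p)

prefix-of-∷ʳ : ∀ {A : Set} (β₁ γ β : List A) a → β₁ ++ γ ≡ β ++ a ∷ [] →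
  ((γ ≡ []) × (β₁ ≡ β ++ a ∷ [])) ⊎ (∃ λ γ′ → β₁ ++ γ′ ≡ β)
prefix-of-∷ʳ []          γ       β       a eq = inj₂ (β , refl)
prefix-of-∷ʳ (x ∷ [])    []      []      a eq = inj₁ (refl , eq)
prefix-of-∷ʳ (x ∷ [])    (_ ∷ _) []      a ()
prefix-of-∷ʳ (x ∷ _ ∷ _) γ       []      a ()
prefix-of-∷ʳ (x ∷ β₁)    γ       (y ∷ β) a eq with ∷-injectiveˡ eq | prefix-of-∷ʳ β₁ γ β a (∷-injectiveʳ eq)
... | refl | inj₁ (γ≡[] , q) = inj₁ (γ≡[] , cong (x ∷_) q)
... | refl | inj₂ (γ′ , q)   = inj₂ (γ′ , cong (x ∷_) q)

∷ʳ≢[] : ∀ {A : Set} (β : List A) a → β ++ a ∷ [] ≢ []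
∷ʳ≢[] β a eq with ++-conicalʳ β (a ∷ []) eq
... | ()

module Spelling (T : Str) where
  open EndPositions T
  open Nodes T

  NoNodeAlong : Str → Str → Set
  NoNodeAlong u β = ∀ β₁ γ → β₁ ++ γ ≡ β → β₁ ≢ [] → ¬ STNode T (u ++ β₁)

  no-node-along-[] : ∀ u → NoNodeAlong u []
  no-node-along-[] u []      γ _  β₁≢[] = ⊥-elim (β₁≢[] refl)
  no-node-along-[] u (_ ∷ _) γ () _

  no-node-along-∷ʳ : ∀ {u β a} → NoNodeAlong u β → ¬ STNode T (u ++ β ++ a ∷ []) → NoNodeAlong u (β ++ a ∷ [])
  no-node-along-∷ʳ {u} {β} {a} none ¬st β₁ γ eq β₁≢[] with prefix-of-∷ʳ β₁ γ β a eq
  ... | inj₁ (_ , refl) = ¬st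
  ... | inj₂ (γ′ , q)   = none β₁ γ′ q β₁≢[]

  first-edge : ∀ {u β a} → CNode T u → NoNodeAlong u β → STNode T (u ++ β ++ a ∷ []) →
    ∃ λ y → IsEdge T (u , β ++ a ∷ [] , y)
  first-edge {u} {β} {a} cu none st with cnode-of-class (u ++ β ++ a ∷ []) u++β++a≢[] st
    where
    u++β++a≢[] : u ++ β ++ a ∷ [] ≢ []
    u++β++a≢[] eq = ∷ʳ≢[] β a (++-conicalʳ u _ eq)
  ... | y , cy , ep = y , cu , cy , ∷ʳ≢[] β a , st , inner , ep
    where
    inner : ∀ β₁ γ → β₁ ++ γ ≡ β ++ a ∷ [] → β₁ ≢ [] → γ ≢ [] → ¬ STNode T (u ++ β₁)
    inner β₁ γ eq β₁≢[] γ≢[] with prefix-of-∷ʳ β₁ γ β a eq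
    ... | inj₁ (γ≡[] , _) = ⊥-elim (γ≢[] γ≡[])
    ... | inj₂ (γ′ , q)   = none β₁ γ′ q β₁≢[]

  PathSpelling : Str → Str → Set
  PathSpelling u s = ∃ λ y → ∃ λ p → CNode T y × EndposEq T (u ++ s) y × Path T u y p × (str p ≡ s)

  path-spelling-∷ : ∀ {u l y w} → IsEdge T (u , l , y) → PathSpelling y w → PathSpelling u (l ++ w)
  path-spelling-∷ {u} {l} {w = w} e (z , p , cz , ep , pp , sp) =
    z , _ ∷ p , cz , subst (λ s → EndposEq T s z) (++-assoc u l w) (ep-trans (ep-++ʳ w (edge-class e)) ep) ,
    e ∷ pp , cong (l ++_) sp

  -- Read w symbol by symbol from the node u, closing an edge whenever a suffix-tree node is reached.
  spell : ∀ w {u} β → CNode T u → NoNodeAlong u β → STNode T (u ++ β ++ w) → PathSpelling u (β ++ w)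
  spell [] {u} [] cu _ _ = u , [] , cu , subst (λ s → EndposEq T s u) (sym (++-identityʳ u)) (ep-refl u) , [] , refl
  spell [] {u} β@(_ ∷ _) _ none st =
    ⊥-elim (none β [] (++-identityʳ β) (λ ()) (subst (λ s → STNode T (u ++ s)) (++-identityʳ β) st))
  spell (a ∷ w) {u} β cu none st with stnode? T (u ++ β ++ a ∷ [])
  ... | yes st₁ = subst (PathSpelling u) (++-assoc β (a ∷ []) w) (continue-from (first-edge cu none st₁))
    where
    st′ : STNode T ((u ++ β ++ a ∷ []) ++ w)
    st′ = subst (STNode T) (trans (cong (u ++_) (sym (++-assoc β (a ∷ []) w))) (sym (++-assoc u (β ++ a ∷ []) w))) st
    continue-from : ∃ (λ y → IsEdge T (u , β ++ a ∷ [] , y)) → PathSpelling u ((β ++ a ∷ []) ++ w)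
    continue-from (y , e) =
      path-spelling-∷ e (spell w [] (edge-target e) (no-node-along-[] y) (stnode-ep (ep-++ʳ w (edge-class e)) y++w≢[] st′))
      where
      y++w≢[] : y ++ w ≢ []
      y++w≢[] eq = ep-≢[] (edge-class e) (λ eq′ → ∷ʳ≢[] β a (++-conicalʳ u _ eq′)) (++-conicalˡ y w eq)
  ... | no ¬st₁ = subst (PathSpelling u) (++-assoc β (a ∷ []) w)
                    (spell w (β ++ a ∷ []) cu (no-node-along-∷ʳ none ¬st₁)
                      (subst (λ s → STNode T (u ++ s)) (sym (++-assoc β (a ∷ []) w)) st))

module Representatives (T : Str) (o : Order) where
  open EndPositions T
  open Paths T

  reprM-root : ReprM T [] []
  reprM-root = [] , λ q pq → ≤-reflexive (cong length (ep-[] (path-endpos pq)))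

  reprP-sink : ReprP T o T []
  reprP-sink = [] , least-[] o
    where
    least-[] : ∀ o q → Path T T T q → [] ⟨ o ⟩ str q
    least-[] lexO q _        = []≤
    least-[] posO [] []      = z≤n
    least-[] posO _  (e ∷ _) = ⊥-elim (no-edge-from-sink e)

  reprM-unique : ∀ {v p p′} → ReprM T v p → ReprM T v p′ → p ≡ p′
  reprM-unique {p = p} {p′} (pp , least) (pp′ , least′) = path-unique pp pp′
    (ep-length⇒≡ (ep-trans (path-endpos pp) (ep-sym (path-endpos pp′)))
      (ep-substring (ep-sym (path-endpos pp′)) (path-substring pp′ (0 , refl)))
      (≤-antisym (least′ p pp) (least p′ pp′)))

  reprP-unique : ∀ {v p p′} → ReprP T o v p → ReprP T o v p′ → p ≡ p′
  reprP-unique {v} {p} {p′} (pp , least) (pp′ , least′) = path-unique pp pp′ (same-string o least least′)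
    where
    same-string : ∀ o → (∀ q → Path T v T q → str p ⟨ o ⟩ str q) →
      (∀ q → Path T v T q → str p′ ⟨ o ⟩ str q) →
      str p ≡ str p′
    same-string lexO least least′ = ≤lex-antisym (least _ pp′) (least′ _ pp)
    same-string posO least least′ = ++-cancelˡ v (str p) (str p′)
      (ep-length⇒≡ (ep-trans (path-endpos pp) (ep-sym (path-endpos pp′)))
        (ep-substring (ep-sym (path-endpos pp′)) (0 , take-all (length T) T ≤-refl))
        (trans (length-++ v) (trans (cong (length v +_) (≤-antisym (least′ _ pp) (least _ pp′))) (sym (length-++ v)))))

  reprM-prefix : ∀ {m v a b} → Path T [] m a → Path T m v b → ReprM T v (a ++ b) → ReprM T m a
  reprM-prefix {a = a} {b} pa pb (_ , least) = pa , λ q pq → +-cancelʳ-≤ (length (str b)) _ _ (begin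
    length (str q) + length (str b)  ≡⟨ length-str-++ q b ⟨
    length (str (q ++ b))            ≤⟨ least (q ++ b) (path-++ pq pb) ⟩
    length (str (a ++ b))            ≡⟨ length-str-++ a b ⟩
    length (str a) + length (str b)  ∎)
    where open ≤-Reasoning

  reprP-suffix : ∀ {v m a b} → Path T v m a → Path T m T b → ReprP T o v (a ++ b) → ReprP T o m b
  reprP-suffix {a = a} {b} pa pb (_ , least) = pb , λ q pq →
    ⟨⟩-cancelˡ o (str a)
      (subst₂ (λ x y → x ⟨ o ⟩ y) (concatMap-++ lab a b) (concatMap-++ lab a q) (least (a ++ q) (path-++ pa pq)))

  reprM-step : ∀ {u l w r} → ReprM T u r → EPm T (u , l , w) → ReprM T w (r ++ (u , l , w) ∷ [])
  reprM-step {u} {l} {w} rep (_ , q , rep′) with path-split q (proj₁ rep′)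
  ... | _ , pq , e ∷ [] =
    subst (λ r → ReprM T w (r ++ (u , l , w) ∷ [])) (reprM-unique (reprM-prefix pq (e ∷ []) rep′) rep) rep′

  reprP-step : ∀ {u l w r} → ReprP T o w r → EPp T o (u , l , w) → ReprP T o u ((u , l , w) ∷ r)
  reprP-step {u} {l} {w} rep (_ , q , rep′@(e ∷ pq , _)) =
    subst (λ r → ReprP T o u ((u , l , w) ∷ r)) (reprP-unique (reprP-suffix (e ∷ []) pq rep′) rep) rep′

  reprM-extend : ∀ {u v r p} → ReprM T u r → Path T u v p → All (EPm T) p → ReprM T v (r ++ p)
  reprM-extend {r = r} rep [] [] = subst (ReprM T _) (sym (++-identityʳ r)) rep
  reprM-extend {r = r} rep (_∷_ {es = es} _ ps) (primary ∷ primaries) =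
    subst (ReprM T _) (++-assoc r _ es) (reprM-extend (reprM-step rep primary) ps primaries)

  reprP-extend : ∀ {v p} → Path T v T p → All (EPp T o) p → ReprP T o v p
  reprP-extend []       []                     = reprP-sink
  reprP-extend (_ ∷ ps) (primary ∷ primaries) = reprP-step (reprP-extend ps primaries) primary

  reprM-primary : ∀ {v r} → ReprM T v r → All (EPm T) r
  reprM-primary {v} {r} rep = primary-after [] r [] (proj₁ rep) rep
    where
    primary-after : ∀ a b {m} → Path T [] m a → Path T m v b → ReprM T v (a ++ b) → All (EPm T) b
    primary-after a []      _  []       _    = []
    primary-after a (f ∷ b) pa (e ∷ pb) rep′ =
      (e , a , reprM-prefix (path-++ pa (e ∷ [])) pb rep″) ∷ primary-after (a ++ f ∷ []) b (path-++ pa (e ∷ [])) pb rep″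
      where
      rep″ : ReprM T v ((a ++ f ∷ []) ++ b)
      rep″ = subst (ReprM T v) (sym (++-assoc a (f ∷ []) b)) rep′

  reprP-primary : ∀ {v r} → ReprP T o v r → All (EPp T o) r
  reprP-primary {v} {r} rep = primary-after [] r [] (proj₁ rep) rep
    where
    primary-after : ∀ a b {m} → Path T v m a → Path T m T b → ReprP T o v (a ++ b) → All (EPp T o) b
    primary-after a []      _  []       _    = []
    primary-after a (f ∷ b) pa (e ∷ pb) rep′ =
      (e , b , reprP-suffix pa (e ∷ pb) rep′) ∷ primary-after (a ++ f ∷ []) b (path-++ pa (e ∷ [])) pb rep″
      where
      rep″ : ReprP T o v ((a ++ f ∷ []) ++ b)
      rep″ = subst (ReprP T o v) (sym (++-assoc a (f ∷ []) b)) rep′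

drop-++ˡ : ∀ {A : Set} i (xs ys : List A) → i ≤ length xs → drop i (xs ++ ys) ≡ drop i xs ++ ys
drop-++ˡ zero    xs       ys _       = refl
drop-++ˡ (suc i) (x ∷ xs) ys (s≤s i≤) = drop-++ˡ i xs ys i≤

end-marker-position : ∀ T′ d p → All (d <_) T′ → Occ (T′ ++ d ∷ []) (d ∷ []) p → p ≡ length T′
end-marker-position []       d zero          _          _  = refl
end-marker-position []       d (suc zero)    _          ()
end-marker-position []       d (suc (suc p)) _          ()
end-marker-position (t ∷ T′) d zero          (d<t ∷ _)  o  = ⊥-elim (<-irrefl (sym (∷-injectiveˡ o)) d<t)
end-marker-position (t ∷ T′) d (suc p)       (_ ∷ d<T′) o  = cong suc (end-marker-position T′ d p d<T′ o)

module Sink (T′ : Str) (d : ℕ) (d<T′ : All (d <_) T′) where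

  T : Str
  T = T′ ++ d ∷ []

  open Nodes T

  T≢[] : T ≢ []
  T≢[] eq = ∷ʳ≢[] T′ d eq

  sink-endsAt : EndsAt T T (length T)
  sink-endsAt = 0 , take-all (length T) T ≤-refl , refl

  endsAt-sink : ∀ {j} → EndsAt T T j → j ≡ length T
  endsAt-sink {j} ea@(i , _ , end) =
    ≤-antisym (endsAt≤length T T j ea T≢[]) (subst (length T ≤_) end (m≤n+m (length T) i))

  -- The end-marker occurs only at the last position, so a suffix of T occurs only as a suffix.
  suffix-endsAt : ∀ {z j} → Suffix T z → EndsAt T z j → j ≡ length T
  suffix-endsAt {j = j} (i , i< , refl) (k , o , end) = begin
    j                                 ≡⟨ end ⟨
    k + length (drop i T)             ≡⟨ cong (λ s → k + length s) split ⟩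
    k + length (drop i T′ ++ d ∷ [])  ≡⟨ cong (k +_) (length-++ (drop i T′)) ⟩
    k + (length (drop i T′) + 1)      ≡⟨ +-assoc k _ 1 ⟨
    k + length (drop i T′) + 1        ≡⟨ cong (_+ 1) marker ⟩
    length T′ + 1                     ≡⟨ length-++ T′ ⟨
    length T                          ∎
    where
    open ≡-Reasoning
    split : drop i T ≡ drop i T′ ++ d ∷ []
    split = drop-++ˡ i T′ (d ∷ []) (≤-pred (subst (i <_) (trans (length-++ T′) (+-comm _ 1)) i<))
    marker : k + length (drop i T′) ≡ length T′
    marker = end-marker-position T′ d _ d<T′ (proj₂ (occ-++⁻ T (drop i T′) (d ∷ []) k (subst (λ s → Occ T s k) split o)))

  suffix-ep : ∀ {z} → Suffix T z → EndposEq T z T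
  suffix-ep suf j = (λ ea → subst (EndsAt T T) (sym (suffix-endsAt suf ea)) sink-endsAt) ,
                    (λ ea → subst (EndsAt T _) (sym (endsAt-sink ea)) (suffix⇒endsAt suf))

  cnode-sink : CNode T T
  cnode-sink = inj₂ (inj₂ (0 , 0<T , refl)) , λ z z~T → ends-before (proj₂ (z~T (length T)) sink-endsAt)
    where
    0<T : 0 < length T
    0<T = subst (0 <_) (sym (trans (length-++ T′) (+-comm _ 1))) (s≤s z≤n)
    ends-before : ∀ {z} → EndsAt T z (length T) → length z ≤ length T
    ends-before {z} (k , _ , end) = subst (length z ≤_) end (m≤n+m (length z) k)

first-occurrence-unique : ∀ {A : Set} {P : A → Set} pre f post pre′ f′ post′ → pre ++ f ∷ post ≡ pre′ ++ f′ ∷ post′ →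
  All (λ e → ¬ P e) pre → All (λ e → ¬ P e) pre′ → P f → P f′ → (pre ≡ pre′) × (f ≡ f′) × (post ≡ post′)
first-occurrence-unique [] f post [] f′ post′ eq _ _ _ _ = refl , ∷-injectiveˡ eq , ∷-injectiveʳ eq
first-occurrence-unique [] f post (x ∷ pre′) f′ post′ eq _ (¬px ∷ _) pf _ with ∷-injectiveˡ eq
... | refl = ⊥-elim (¬px pf)
first-occurrence-unique (x ∷ pre) f post [] f′ post′ eq (¬px ∷ _) _ _ pf′ with ∷-injectiveˡ eq
... | refl = ⊥-elim (¬px pf′)
first-occurrence-unique (x ∷ pre) f post (y ∷ pre′) f′ post′ eq (_ ∷ ¬ps) (_ ∷ ¬ps′) pf pf′ with ∷-injectiveˡ eq
... | refl with first-occurrence-unique pre f post pre′ f′ post′ (∷-injectiveʳ eq) ¬ps ¬ps′ pf pf′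
...   | pre≡ , f≡ , post≡ = cong (x ∷_) pre≡ , f≡ , post≡

last-occurrence-unique : ∀ {A : Set} {P : A → Set} pre f post pre′ f′ post′ → pre ++ f ∷ post ≡ pre′ ++ f′ ∷ post′ →
  All (λ e → ¬ P e) post → All (λ e → ¬ P e) post′ → P f → P f′ → (pre ≡ pre′) × (f ≡ f′) × (post ≡ post′)
last-occurrence-unique [] f post [] f′ post′ eq _ _ _ _ = refl , ∷-injectiveˡ eq , ∷-injectiveʳ eq
last-occurrence-unique [] f post (x ∷ pre′) f′ post′ eq ¬ps _ _ pf′ with ++⁻ʳ pre′ (subst (All _) (∷-injectiveʳ eq) ¬ps)
... | ¬pf′ ∷ _ = ⊥-elim (¬pf′ pf′)
last-occurrence-unique (x ∷ pre) f post [] f′ post′ eq _ ¬ps′ pf _ with ++⁻ʳ pre (subst (All _) (sym (∷-injectiveʳ eq)) ¬ps′)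
... | ¬pf ∷ _ = ⊥-elim (¬pf pf)
last-occurrence-unique (x ∷ pre) f post (y ∷ pre′) f′ post′ eq ¬ps ¬ps′ pf pf′ with ∷-injectiveˡ eq
... | refl with last-occurrence-unique pre f post pre′ f′ post′ (∷-injectiveʳ eq) ¬ps ¬ps′ pf pf′
...   | pre≡ , f≡ , post≡ = cong (x ∷_) pre≡ , f≡ , post≡

All-middle : ∀ {A : Set} {P : A → Set} pre f post → All P (pre ++ f ∷ post) → P f
All-middle pre f post ps with ++⁻ʳ pre ps
... | pf ∷ _ = pf

module Canonicity (T : Str) (o : Order) where
  open Paths T
  open Representatives T o

  primary⇒¬secondary : ∀ δ {p} → All (EP T o δ) p → All (λ e → ¬ ES T o δ e) p
  primary⇒¬secondary δ = All.map (λ primary secondary → proj₂ secondary primary)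

  factoring-unique : ∀ δ S pre f post pre′ f′ post′ →
    Factoring T o δ S pre f post → Factoring T o δ S pre′ f′ post′ →
    (pre ≡ pre′) × (f ≡ f′) × (post ≡ post′)
  factoring-unique minus S pre f post pre′ f′ post′ (pp , sp , _ , sf , _ , highest) (pp′ , sp′ , _ , sf′ , _ , highest′) =
    first-occurrence-unique pre f post pre′ f′ post′ (path-unique pp pp′ (trans sp (sym sp′))) highest highest′ sf sf′
  factoring-unique plus S pre f post pre′ f′ post′ (pp , sp , _ , sf , _ , lowest) (pp′ , sp′ , _ , sf′ , _ , lowest′) =
    last-occurrence-unique pre f post pre′ f′ post′ (path-unique pp pp′ (trans sp (sym sp′))) lowest lowest′ sf sf′

  trivial-not-factoring : ∀ δ {S pre f post} → Trivial T o δ S → ¬ Factoring T o δ S pre f post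
  trivial-not-factoring δ {pre = pre} {f} {post} (p , pp , sp , primaries) (pf , sf , _ , (_ , ¬primary) , _) =
    ¬primary (All-middle pre f post (subst (All (EP T o δ)) (path-unique pp pf (trans sp (sym sf))) primaries))

  certificate-unique : ∀ δ S c c′ → Cert T o δ S c → Cert T o δ S c′ → c ≡ c′
  certificate-unique δ S c c′ (inj₁ (c≡ , _)) (inj₁ (c′≡ , _)) = trans c≡ (sym c′≡)
  certificate-unique δ S c c′ (inj₁ (_ , triv)) (inj₂ (_ , _ , _ , _ , fact)) = ⊥-elim (trivial-not-factoring δ triv fact)
  certificate-unique δ S c c′ (inj₂ (_ , _ , _ , _ , fact)) (inj₁ (_ , triv)) = ⊥-elim (trivial-not-factoring δ triv fact)
  certificate-unique δ S c c′ (inj₂ (pre , f , post , c≡ , fact)) (inj₂ (pre′ , f′ , post′ , c′≡ , fact′)) =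
    trans c≡ (trans (cong just (proj₁ (proj₂ (factoring-unique δ S pre f post pre′ f′ post′ fact fact′)))) (sym c′≡))

  certificate-in-dom : ∀ δ S c → Cert T o δ S c → Dom T o δ c
  certificate-in-dom δ S c (inj₁ (c≡ , _)) = inj₁ c≡
  certificate-in-dom δ S c (inj₂ (_ , f , _ , c≡ , (_ , _ , _ , secondary , _))) = inj₂ (f , c≡ , secondary)

  -- A path of primary edges is a representative path, and representatives are unique.
  trivial-path-unique : ∀ δ {p p′} → Path T [] T p → All (EP T o δ) p →
    Path T [] T p′ → All (EP T o δ) p′ → p ≡ p′
  trivial-path-unique minus pp ps pp′ ps′ = reprM-unique (reprM-extend reprM-root pp ps) (reprM-extend reprM-root pp′ ps′)
  trivial-path-unique plus  pp ps pp′ ps′ = reprP-unique (reprP-extend pp ps) (reprP-extend pp′ ps′)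

  cano-unique : ∀ δ c S S′ → Cert T o δ S c → Cert T o δ S′ c → S ≡ S′
  cano-unique δ c S S′ (inj₁ (_ , p , pp , sp , ps)) (inj₁ (_ , p′ , pp′ , sp′ , ps′)) =
    trans (sym sp) (trans (cong str (trivial-path-unique δ pp ps pp′ ps′)) sp′)
  cano-unique δ c S S′ (inj₁ (refl , _)) (inj₂ (_ , _ , _ , () , _))
  cano-unique δ c S S′ (inj₂ (_ , _ , _ , refl , _)) (inj₁ (() , _))
  cano-unique δ c S S′ (inj₂ (pre , f , post , refl , (pp , sp , pre-primary , _ , post-primary , _)))
                       (inj₂ (pre′ , f′ , post′ , c≡ , (pp′ , sp′ , pre-primary′ , _ , post-primary′ , _)))
    with just-injective c≡
  ... | refl with path-around pre f post pp | path-around pre′ f post′ pp′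
  ...   | pre-path , post-path | pre-path′ , post-path′ =
    trans (sym sp) (trans (cong₂ (λ a b → str (a ++ f ∷ b))
      (reprM-unique (reprM-extend reprM-root pre-path pre-primary) (reprM-extend reprM-root pre-path′ pre-primary′))
      (reprP-unique (reprP-extend post-path post-primary) (reprP-extend post-path′ post-primary′))) sp′)

  canonical-factoring : ∀ δ {u l w pre post} → ReprM T u pre → ReprP T o w post → ES T o δ (u , l , w) →
    Factoring T o δ (str (pre ++ (u , l , w) ∷ post)) pre (u , l , w) post
  canonical-factoring minus rm rp secondary@(e , _) =
    path-++ (proj₁ rm) (e ∷ proj₁ rp) , refl , reprM-primary rm , secondary , reprP-primary rp ,
    primary⇒¬secondary minus (reprM-primary rm)
  canonical-factoring plus  rm rp secondary@(e , _) =
    path-++ (proj₁ rm) (e ∷ proj₁ rp) , refl , reprM-primary rm , secondary , reprP-primary rp ,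
    primary⇒¬secondary plus (reprP-primary rp)

module Existence (T′ : Str) (d : ℕ) (d<T′ : All (d <_) T′) (o : Order) where
  open Sink T′ d d<T′
  open EndPositions T
  open Nodes T
  open Paths T
  open Spelling T
  open Representatives T o
  open Canonicity T o

  reprM-exists : ∀ {v} → CNode T v → ∃ (ReprM T v)
  reprM-exists {v} cv with spell v [] cnode-root (no-node-along-[] []) (proj₁ cv)
  ... | y , p , cy , ep , pp , sp with cnode-unique cy cv (ep-sym ep)
  ... | refl = p , pp , λ q pq → subst (length (str q) ≤_) (cong length (sym sp)) (proj₂ cv (str q) (path-endpos pq))

  sink-reachable : ∀ v → Substring T v → ∃ λ s → s ∈ suffixes T × EndposEq T (v ++ s) T
  sink-reachable []         _          = T , drop∈suffixes 0 T , ep-refl T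
  sink-reachable v@(c ∷ v′) (i , occ) = drop (i + length v) T , drop∈suffixes (i + length v) T , suffix-ep (i , i< , sym v++s≡)
    where
    v++s≡ : v ++ drop (i + length v) T ≡ drop i T
    v++s≡ = trans (cong₂ _++_ (sym occ) (sym (drop-drop i (length v) T))) (take++drop≡id (length v) (drop i T))
    i< : i < length T
    i< = <-≤-trans (m<m+n i (s≤s z≤n)) (occ-end≤ T c v′ i occ)

  endsAt-end⇒stnode : ∀ z → EndsAt T z (length T) → STNode T z
  endsAt-end⇒stnode []      _  = inj₁ refl
  endsAt-end⇒stnode (c ∷ z) ea = inj₂ (inj₂ (endsAt⇒suffix (λ ()) ea))

  path-to-sink∈suffixes : ∀ {v q} → Path T v T q → str q ∈ suffixes T
  path-to-sink∈suffixes {v} {q} pq = subst (λ t → str q ∈ suffixes t) (take-all (length T) T ≤-refl)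
    (endsAt⇒∈suffixes T (str q) (length T) (endsAt-++⁻ʳ v (proj₂ (path-endpos pq (length T)) sink-endsAt)))

  -- repr₊(v) is the ⪯₊-least suffix s of T with v ++ s in the class of the sink; the path spelling it ends there.
  reprP-exists : ∀ {v} → CNode T v → ∃ (ReprP T o v)
  reprP-exists {v} cv with sink-reachable v (stnode-substring (proj₁ cv))
  ... | s , s∈ , v++s~T with least-exists o (λ s → endposEq? T (v ++ s) T T≢[]) (suffixes T) s∈ v++s~T
  ... | m , v++m~T , least
    with spell m [] cv (no-node-along-[] v) (endsAt-end⇒stnode (v ++ m) (proj₂ (v++m~T (length T)) sink-endsAt))
  ... | y , p , cy , ep , pp , sp with cnode-unique cy cnode-sink (ep-trans (ep-sym ep) v++m~T)
  ... | refl = p , pp , λ q pq →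
    subst (λ s → s ⟨ o ⟩ str q) (sym sp) (least (str q) (path-to-sink∈suffixes pq) (path-endpos pq))

  cano-exists : ∀ δ c → Dom T o δ c → ∃ λ S → Cert T o δ S c
  cano-exists minus c (inj₁ refl) with reprM-exists cnode-sink
  ... | p , rep = str p , inj₁ (refl , p , proj₁ rep , refl , reprM-primary rep)
  cano-exists plus c (inj₁ refl) with reprP-exists cnode-root
  ... | p , rep = str p , inj₁ (refl , p , proj₁ rep , refl , reprP-primary rep)
  cano-exists δ c (inj₂ (f , refl , secondary@(e , _))) with reprM-exists (edge-source e) | reprP-exists (edge-target e)
  ... | pre , rm | post , rp = _ , inj₂ (pre , f , post , refl , canonical-factoring δ rm rp secondary)

lemma2 : (T : Str) → EndMarked T → (o : Order) → (δ : Sign) →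
    -- uniqueness of the δ-canonical factoring
    (∀ S pre f post pre′ f′ post′ →
       Factoring T o δ S pre f post → Factoring T o δ S pre′ f′ post′ →
       (pre ≡ pre′) × (f ≡ f′) × (post ≡ post′))
    -- uniqueness of the δ-certificate (injectivity of cano_δ)
    × (∀ S c c′ → Cert T o δ S c → Cert T o δ S c′ → c ≡ c′)
    -- cano_δ is well defined on ES_δ ∪ {f^⊥_δ}: existence ...
    × (∀ c → Dom T o δ c → Σ Str λ S → Cert T o δ S c)
    -- ... and uniqueness of the δ-canonical suffix with certificate c
    × (∀ c S S′ → Dom T o δ c → Cert T o δ S c → Cert T o δ S′ c → S ≡ S′)
    -- cano_δ maps into CS_δ and hits every element of CS_δ
    × (∀ S c → Cert T o δ S c → Dom T o δ c)
    × (∀ S → Canonical T o δ S → Σ (Maybe Edge) λ c → Dom T o δ c × Cert T o δ S c)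
lemma2 T (T′ , d , refl , d<T′) o δ =
  factoring-unique δ , certificate-unique δ , cano-exists δ , (λ c S S′ _ → cano-unique δ c S S′) ,
  certificate-in-dom δ , λ { S (c , cert) → c , certificate-in-dom δ S c cert , cert }
  where
  open Canonicity T o
  open Existence T′ d d<T′ o
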